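{- For every constant specification $CS$ for $\mathcal{GJT}_0$: $(Th_{\mathcal{GJT}_{CS}})^\circ\subsetneq Th_{\mathcal{GT}_\Box}$.
   Context: Justification terms $Jt$ are generated by $t::= c\mid x\mid [t+t]\mid [t\cdot t]\mid\, !t\mid\, ?t$, where $c$ ranges over constants $C=\{c_i\mid i\in\mathbb{N}\}$ and $x$ over variables $V=\{x_i\}$. The language $\mathcal{L}_J$ is $\phi::=\bot\mid p\mid(\phi\rightarrow\phi)\mid(\phi\land\phi)\mid t:\phi$ with $p\in Var=\{p_i\mid i\in\mathbb{N}\}$; $\neg\phi:=\phi\rightarrow\bot$. The modal language $\mathcal{L}_\Box$ is $\phi::=\bot\mid p\mid(\phi\land\phi)\mid(\phi\rightarrow\phi)\mid\Box\phi$. The calculus $\mathcal{G}$ has the axiom schemes (A1) $(\phi\rightarrow\psi)\rightarrow((\psi\rightarrow\chi)\rightarrow(\phi\rightarrow\chi))$; (A2) $(\phi\land\psi)\rightarrow\phi$; (A3) $(\phi\land\psi)\rightarrow(\psi\land\phi)$; (A5a) $(\phi\rightarrow(\psi\rightarrow\chi))\rightarrow((\phi\land\psi)\rightarrow\chi)$; (A5b) $((\phi\land\psi)\rightarrow\chi)\rightarrow(\phi\rightarrow(\psi\rightarrow\chi))$; (A6) $((\phi\rightarrow\psi)\rightarrow\chi)\rightarrow(((\psi\rightarrow\phi)\rightarrow\chi)\rightarrow\chi)$; (A7) $\bot\rightarrow\phi$; (G4) $\phi\rightarrow(\phi\land\phi)$; and the rule (MP): from $\phi\rightarrow\psi$ and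 $\phi$ infer $\psi$. $\mathcal{GJT}_0$ is $\mathcal{G}$ over $\mathcal{L}_J$ plus (J) $t:(\phi\rightarrow\psi)\rightarrow(s:\phi\rightarrow[t\cdot s]:\psi)$, (+) $t:\phi\rightarrow[t+s]:\phi$, $s:\phi\rightarrow[t+s]:\phi$, and (F) $t:\phi\rightarrow\phi$. A constant specification for $\mathcal{GJT}_0$ is a set $CS$ of formulas $c_{i_n}:\dots:c_{i_1}:\phi$ ($n\ge1$, $c_{i_k}\in C$, $\phi$ an axiom instance of $\mathcal{GJT}_0$) such that whenever $c_{i_n}:\dots:c_{i_1}:\phi\in CS$, also $c_{i_k}:\dots:c_{i_1}:\phi\in CS$ for all $k\le n$. $\mathcal{GJT}_{CS}$ is $\mathcal{GJT}_0$ plus the rule: from $c:\phi\in CS$ infer $c:\phi$. $\mathcal{GT}_\Box$ over $\mathcal{L}_\Box$ consists of the axiom schemes of $\mathcal{G}$, (K) $\Box(\phi\rightarrow\psi)\rightarrow(\Box\phi\rightarrow\Box\psi)$, (Z) $\neg\neg\Box\phi\rightarrow\Box\neg\neg\phi$, (T) $\Box\phi\rightarrow\phi$, the rule (MP), and the rule (N$\Box$): from a theorem $\phi$ infer $\Box\phi$. For a proof system $\mathcal{S}$ over $\mathcal{L}$, $Th_\mathcal{S}=\{\phi\in\mathcal{L}\mid\ \vdash_\mathcal{S}\phi\}$. The forgetful projection $\circ:\mathcal{L}_J\to\mathcal{L}_\Box$ is given by $p^\circ=p$, $\bot^\circ=\bot$, $(\phi\land\psi)^\circ=\phi^\circ\land\psi^\circ$,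 $(\phi\rightarrow\psi)^\circ=\phi^\circ\rightarrow\psi^\circ$, $(t:\phi)^\circ=\Box\phi^\circ$, and $\Gamma^\circ=\{\phi^\circ\mid\phi\in\Gamma\}$. -}

module Defs where

open import Data.Nat using (ℕ)

data Tm : Set where
  con  : ℕ → Tm
  var  : ℕ → Tm
  _⊕_  : Tm → Tm → Tm
  _⊙_  : Tm → Tm → Tm
  !_   : Tm → Tm
  ⁇_   : Tm → Tm

infixr 6 _⇒_
infixr 7 _∧_
infix  8 _∶_

data JFm : Set where
  ⊥J   : JFm
  atm  : ℕ → JFm
  _⇒_  : JFm → JFm → JFm
  _∧_  : JFm → JFm → JFm
  _∶_  : Tm → JFm → JFm

¬J : JFm → JFm
¬J φ = φ ⇒ ⊥J

infixr 6 _⇒□_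
infixr 7 _∧□_

data MFm : Set where
  ⊥□   : MFm
  atm□ : ℕ → MFm
  _∧□_ : MFm → MFm → MFm
  _⇒□_ : MFm → MFm → MFm
  □_   : MFm → MFm

¬□ : MFm → MFm
¬□ φ = φ ⇒□ ⊥□

data JAxiom : JFm → Set where
  A1  : ∀ φ ψ χ → JAxiom ((φ ⇒ ψ) ⇒ ((ψ ⇒ χ) ⇒ (φ ⇒ χ)))
  A2  : ∀ φ ψ → JAxiom ((φ ∧ ψ) ⇒ φ)
  A3  : ∀ φ ψ → JAxiom ((φ ∧ ψ) ⇒ (ψ ∧ φ))
  A5a : ∀ φ ψ χ → JAxiom ((φ ⇒ (ψ ⇒ χ)) ⇒ ((φ ∧ ψ) ⇒ χ))
  A5b : ∀ φ ψ χ → JAxiom (((φ ∧ ψ) ⇒ χ) ⇒ (φ ⇒ (ψ ⇒ χ)))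
  A6  : ∀ φ ψ χ → JAxiom (((φ ⇒ ψ) ⇒ χ) ⇒ (((ψ ⇒ φ) ⇒ χ) ⇒ χ))
  A7  : ∀ φ → JAxiom (⊥J ⇒ φ)
  G4  : ∀ φ → JAxiom (φ ⇒ (φ ∧ φ))
  J   : ∀ t s φ ψ → JAxiom ((t ∶ (φ ⇒ ψ)) ⇒ ((s ∶ φ) ⇒ ((t ⊙ s) ∶ ψ)))
  +l  : ∀ t s φ → JAxiom ((t ∶ φ) ⇒ ((t ⊕ s) ∶ φ))
  +r  : ∀ t s φ → JAxiom ((s ∶ φ) ⇒ ((t ⊕ s) ∶ φ))
  F   : ∀ t φ → JAxiom ((t ∶ φ) ⇒ φ)

data ConstChain : JFm → Set where
  base : ∀ i {φ} → JAxiom φ → ConstChain (con i ∶ φ)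
  step : ∀ i {ψ} → ConstChain ψ → ConstChain (con i ∶ ψ)

-- A constant specification: a set (predicate) of such formulas, closed
-- under removing outer constants (iterating this gives closure under
-- c_{i_k}:...:c_{i_1}:φ for every k ≤ n).
record IsConstSpec (CS : JFm → Set) : Set where
  field
    shape  : ∀ {φ} → CS φ → ConstChain φ
    closed : ∀ {i ψ} → CS (con i ∶ ψ) → ConstChain ψ → CS ψ

data _⊢J_ (CS : JFm → Set) : JFm → Set where
  ax : ∀ {φ} → JAxiom φ → CS ⊢J φ
  cs : ∀ {φ} → CS φ → CS ⊢J φ
  mp : ∀ {φ ψ} → CS ⊢J (φ ⇒ ψ) → CS ⊢J φ → CS ⊢J ψ

data MAxiom : MFm → Set where
  A1  : ∀ φ ψ χ → MAxiom ((φ ⇒□ ψ) ⇒□ ((ψ ⇒□ χ) ⇒□ (φ ⇒□ χ)))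
  A2  : ∀ φ ψ → MAxiom ((φ ∧□ ψ) ⇒□ φ)
  A3  : ∀ φ ψ → MAxiom ((φ ∧□ ψ) ⇒□ (ψ ∧□ φ))
  A5a : ∀ φ ψ χ → MAxiom ((φ ⇒□ (ψ ⇒□ χ)) ⇒□ ((φ ∧□ ψ) ⇒□ χ))
  A5b : ∀ φ ψ χ → MAxiom (((φ ∧□ ψ) ⇒□ χ) ⇒□ (φ ⇒□ (ψ ⇒□ χ)))
  A6  : ∀ φ ψ χ → MAxiom (((φ ⇒□ ψ) ⇒□ χ) ⇒□ (((ψ ⇒□ φ) ⇒□ χ) ⇒□ χ))
  A7  : ∀ φ → MAxiom (⊥□ ⇒□ φ)
  G4  : ∀ φ → MAxiom (φ ⇒□ (φ ∧□ φ))
  K   : ∀ φ ψ → MAxiom ((□ (φ ⇒□ ψ)) ⇒□ ((□ φ) ⇒□ (□ ψ)))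
  Z   : ∀ φ → MAxiom ((¬□ (¬□ (□ φ))) ⇒□ (□ (¬□ (¬□ φ))))
  T   : ∀ φ → MAxiom ((□ φ) ⇒□ φ)

data ⊢□_ : MFm → Set where
  ax  : ∀ {φ} → MAxiom φ → ⊢□ φ
  mp  : ∀ {φ ψ} → ⊢□ (φ ⇒□ ψ) → ⊢□ φ → ⊢□ ψ
  nec : ∀ {φ} → ⊢□ φ → ⊢□ (□ φ)

_° : JFm → MFm
⊥J ° = ⊥□
atm p ° = atm□ p
(φ ⇒ ψ) ° = (φ °) ⇒□ (ψ °)
(φ ∧ ψ) ° = (φ °) ∧□ (ψ °)
(t ∶ φ) ° = □ (φ °)

-- Projecting a GJT_CS derivation gives a GT□ derivation: the axioms J, F
-- and (+) become K, T and φ → φ, and an element c_n : … : c_1 : φ of the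
-- constant specification becomes the necessitation of the axiom φ° n times.
-- The inclusion is strict because GJT_CS has no counterpart of Z.  To see
-- this, interpret L_□ in the product of two copies of the three-element
-- Gödel chain 0 < ½ < 1, with □ fixing the top element and capping each
-- coordinate at ½ otherwise.  Every axiom of GJT_0 projects to a valid
-- formula, □ preserves validity and validity is closed under modus ponens,
-- so the projection of every GJT_CS theorem is valid; the instance of Z at
-- an atom valued (0, ½) is not.
module Submission where

open import Defs
open import Data.Product using (Σ; _×_; _,_)
open import Data.Product.Properties using (≡-dec)
open import Relation.Nullary using (¬_; Dec; yes; no)
open import Relation.Nullary.Decidable using (True; toWitness; map′; _×-dec_)
open import Relation.Binary.Definitions using (DecidableEquality)
open import Relation.Binary.PropositionalEquality using (_≡_; refl; cong; subst)
open import Relation.Unary using (Decidable)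

⇒□-refl : ∀ φ → ⊢□ (φ ⇒□ φ)
⇒□-refl φ = mp (mp (ax (A1 φ (φ ∧□ φ) φ)) (ax (G4 φ))) (ax (A2 φ φ))

axiom-° : ∀ {φ} → JAxiom φ → ⊢□ (φ °)
axiom-° (A1 _ _ _)  = ax (A1 _ _ _)
axiom-° (A2 _ _)    = ax (A2 _ _)
axiom-° (A3 _ _)    = ax (A3 _ _)
axiom-° (A5a _ _ _) = ax (A5a _ _ _)
axiom-° (A5b _ _ _) = ax (A5b _ _ _)
axiom-° (A6 _ _ _)  = ax (A6 _ _ _)
axiom-° (A7 _)      = ax (A7 _)
axiom-° (G4 _)      = ax (G4 _)
axiom-° (J _ _ _ _) = ax (K _ _)
axiom-° (+l _ _ φ)  = ⇒□-refl (□ (φ °))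
axiom-° (+r _ _ φ)  = ⇒□-refl (□ (φ °))
axiom-° (F _ _)     = ax (T _)

constChain-° : ∀ {φ} → ConstChain φ → ⊢□ (φ °)
constChain-° (base _ a) = nec (axiom-° a)
constChain-° (step _ c) = nec (constChain-° c)

derivable-° : ∀ {CS} → IsConstSpec CS → ∀ {φ} → CS ⊢J φ → ⊢□ (φ °)
derivable-° _   (ax a)   = axiom-° a
derivable-° isc (cs c)   = constChain-° (IsConstSpec.shape isc c)
derivable-° isc (mp d e) = mp (derivable-° isc d) (derivable-° isc e)

data G₃ : Set where
  𝟘 ½ 𝟙 : G₃

_≟₃_ : DecidableEquality G₃
𝟘 ≟₃ 𝟘 = yes refl
½ ≟₃ ½ = yes refl
𝟙 ≟₃ 𝟙 = yes refl
𝟘 ≟₃ ½ = no λ ()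
𝟘 ≟₃ 𝟙 = no λ ()
½ ≟₃ 𝟘 = no λ ()
½ ≟₃ 𝟙 = no λ ()
𝟙 ≟₃ 𝟘 = no λ ()
𝟙 ≟₃ ½ = no λ ()

∀₃? : {P : G₃ → Set} → Decidable P → Dec (∀ x → P x)
∀₃? P? = map′ (λ (p₀ , p½ , p₁) → λ { 𝟘 → p₀ ; ½ → p½ ; 𝟙 → p₁ })
              (λ h → h 𝟘 , h ½ , h 𝟙)
              (P? 𝟘 ×-dec P? ½ ×-dec P? 𝟙)

_⊓₃_ : G₃ → G₃ → G₃
𝟘 ⊓₃ _ = 𝟘
½ ⊓₃ 𝟘 = 𝟘
½ ⊓₃ _ = ½
𝟙 ⊓₃ y = y

-- Gödel implication: 1 if x ≤ y, and y otherwise.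
_⇨₃_ : G₃ → G₃ → G₃
𝟘 ⇨₃ _ = 𝟙
½ ⇨₃ 𝟘 = 𝟘
½ ⇨₃ _ = 𝟙
𝟙 ⇨₃ y = y

Val : Set
Val = G₃ × G₃

_≟ᵛ_ : DecidableEquality Val
_≟ᵛ_ = ≡-dec _≟₃_ _≟₃_

∀ᵛ? : {P : Val → Set} → Decidable P → Dec (∀ v → P v)
∀ᵛ? P? = map′ (λ h (a , b) → h a b) (λ h a b → h (a , b))
              (∀₃? λ a → ∀₃? λ b → P? (a , b))

⊤ᵛ : Val
⊤ᵛ = 𝟙 , 𝟙

_⊓ᵛ_ : Val → Val → Val
(a , b) ⊓ᵛ (c , d) = a ⊓₃ c , b ⊓₃ d

_⇨ᵛ_ : Val → Val → Val
(a , b) ⇨ᵛ (c , d) = a ⇨₃ c , b ⇨₃ d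

□ᵛ : Val → Val
□ᵛ (𝟙 , 𝟙) = ⊤ᵛ
□ᵛ (a , b) = a ⊓₃ ½ , b ⊓₃ ½

⟦_⟧ : MFm → Val
⟦ ⊥□ ⟧     = 𝟘 , 𝟘
⟦ atm□ _ ⟧ = 𝟘 , ½
⟦ φ ∧□ ψ ⟧ = ⟦ φ ⟧ ⊓ᵛ ⟦ ψ ⟧
⟦ φ ⇒□ ψ ⟧ = ⟦ φ ⟧ ⇨ᵛ ⟦ ψ ⟧
⟦ □ φ ⟧    = □ᵛ ⟦ φ ⟧

Valid : MFm → Set
Valid φ = ⟦ φ ⟧ ≡ ⊤ᵛ

tautology₁ : (f : Val → Val) → {True (∀ᵛ? λ a → f a ≟ᵛ ⊤ᵛ)} →
             ∀ a → f a ≡ ⊤ᵛ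
tautology₁ f {t} = toWitness t

tautology₂ : (f : Val → Val → Val) →
             {True (∀ᵛ? λ a → ∀ᵛ? λ b → f a b ≟ᵛ ⊤ᵛ)} →
             ∀ a b → f a b ≡ ⊤ᵛ
tautology₂ f {t} = toWitness t

tautology₃ : (f : Val → Val → Val → Val) →
             {True (∀ᵛ? λ a → ∀ᵛ? λ b → ∀ᵛ? λ c → f a b c ≟ᵛ ⊤ᵛ)} →
             ∀ a b c → f a b c ≡ ⊤ᵛ
tautology₃ f {t} = toWitness t

axiom-valid : ∀ {φ} → JAxiom φ → Valid (φ °)
axiom-valid (A1 φ ψ χ) =
  tautology₃ (λ a b c → (a ⇨ᵛ b) ⇨ᵛ ((b ⇨ᵛ c) ⇨ᵛ (a ⇨ᵛ c))) ⟦ φ ° ⟧ ⟦ ψ ° ⟧ ⟦ χ ° ⟧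
axiom-valid (A2 φ ψ) =
  tautology₂ (λ a b → (a ⊓ᵛ b) ⇨ᵛ a) ⟦ φ ° ⟧ ⟦ ψ ° ⟧
axiom-valid (A3 φ ψ) =
  tautology₂ (λ a b → (a ⊓ᵛ b) ⇨ᵛ (b ⊓ᵛ a)) ⟦ φ ° ⟧ ⟦ ψ ° ⟧
axiom-valid (A5a φ ψ χ) =
  tautology₃ (λ a b c → (a ⇨ᵛ (b ⇨ᵛ c)) ⇨ᵛ ((a ⊓ᵛ b) ⇨ᵛ c)) ⟦ φ ° ⟧ ⟦ ψ ° ⟧ ⟦ χ ° ⟧
axiom-valid (A5b φ ψ χ) =
  tautology₃ (λ a b c → ((a ⊓ᵛ b) ⇨ᵛ c) ⇨ᵛ (a ⇨ᵛ (b ⇨ᵛ c))) ⟦ φ ° ⟧ ⟦ ψ ° ⟧ ⟦ χ ° ⟧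
axiom-valid (A6 φ ψ χ) =
  tautology₃ (λ a b c → ((a ⇨ᵛ b) ⇨ᵛ c) ⇨ᵛ (((b ⇨ᵛ a) ⇨ᵛ c) ⇨ᵛ c)) ⟦ φ ° ⟧ ⟦ ψ ° ⟧ ⟦ χ ° ⟧
axiom-valid (A7 φ) =
  tautology₁ (λ a → (𝟘 , 𝟘) ⇨ᵛ a) ⟦ φ ° ⟧
axiom-valid (G4 φ) =
  tautology₁ (λ a → a ⇨ᵛ (a ⊓ᵛ a)) ⟦ φ ° ⟧
axiom-valid (J _ _ φ ψ) =
  tautology₂ (λ a b → □ᵛ (a ⇨ᵛ b) ⇨ᵛ (□ᵛ a ⇨ᵛ □ᵛ b)) ⟦ φ ° ⟧ ⟦ ψ ° ⟧
axiom-valid (+l _ _ φ) =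
  tautology₁ (λ a → □ᵛ a ⇨ᵛ □ᵛ a) ⟦ φ ° ⟧
axiom-valid (+r _ _ φ) =
  tautology₁ (λ a → □ᵛ a ⇨ᵛ □ᵛ a) ⟦ φ ° ⟧
axiom-valid (F _ φ) =
  tautology₁ (λ a → □ᵛ a ⇨ᵛ a) ⟦ φ ° ⟧

constChain-valid : ∀ {φ} → ConstChain φ → Valid (φ °)
constChain-valid (base _ a) = cong □ᵛ (axiom-valid a)
constChain-valid (step _ c) = cong □ᵛ (constChain-valid c)

⊤ᵛ-mp : ∀ {x y} → x ≡ ⊤ᵛ → x ⇨ᵛ y ≡ ⊤ᵛ → y ≡ ⊤ᵛ
⊤ᵛ-mp refl x⇨y≡⊤ = x⇨y≡⊤

derivable-valid : ∀ {CS} → IsConstSpec CS → ∀ {φ} → CS ⊢J φ → Valid (φ °)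
derivable-valid _   (ax a)   = axiom-valid a
derivable-valid isc (cs c)   = constChain-valid (IsConstSpec.shape isc c)
derivable-valid isc (mp d e) = ⊤ᵛ-mp (derivable-valid isc e) (derivable-valid isc d)

Z-atom : MFm
Z-atom = ¬□ (¬□ (□ (atm□ 0))) ⇒□ □ (¬□ (¬□ (atm□ 0)))

Z-atom-invalid : ¬ Valid Z-atom
Z-atom-invalid ()

mainTheorem11 : (CS : JFm → Set) → IsConstSpec CS →
    ((φ : JFm) → CS ⊢J φ → ⊢□ (φ °))
    × Σ MFm (λ ψ → (⊢□ ψ) × ¬ (Σ JFm (λ φ → (CS ⊢J φ) × (φ ° ≡ ψ))))
mainTheorem11 CS isc =
  (λ _ → derivable-° isc) ,
  (Z-atom , ax (Z _) , λ (φ , d , φ°≡Z) →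
    Z-atom-invalid (subst Valid φ°≡Z (derivable-valid isc d)))
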